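{- Let $l,r$ be functions from regular expressions over $\Sigma$ to regular expressions over $\Sigma$, with $l$ linear and $r$ monotone. Let $H=\{l(e)\le r(e)\mid e \text{ a regular expression over }\Sigma\}$ and $H'=\{l(w)\le r(w)\mid w\in\Sigma^*\}$ (words viewed as regular expressions). Then the one-step functions of $H$ and $H'$ are equal.
   Context: Regular expressions over an alphabet $\Sigma$ with usual language $\llbracket e\rrbracket$. A function $h$ on regular expressions is monotone if $\llbracket e\rrbracket\subseteq\llbracket f\rrbracket$ implies $\llbracket h(e)\rrbracket\subseteq\llbracket h(f)\rrbracket$, and linear if $\llbracket h(e)\rrbracket=\bigcup_{w\in\llbracket e\rrbracket}\llbracket h(w)\rrbracket$ for all $e$. A hypothesis is a pair $e\le f$. For a set $G$ of hypotheses, its one-step function on languages is $G(L)=\bigcup\{u\llbracket e\rrbracket v\mid e\le f\in G,\ u,v\in\Sigma^*,\ u\llbracket f\rrbracket v\subseteq L\}$. -}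

module Defs where

open import Data.List using (List; []; _∷_; _++_; foldr)
open import Data.Product using (Σ; _×_; _,_; ∃; ∃-syntax)
open import Data.Empty using (⊥)
open import Relation.Binary.PropositionalEquality using (_≡_)

data RegExp (A : Set) : Set where
  𝟘   : RegExp A
  𝟙   : RegExp A
  lit : A → RegExp A
  _⊕_ : RegExp A → RegExp A → RegExp A
  _⊙_ : RegExp A → RegExp A → RegExp A
  _⋆  : RegExp A → RegExp A

Lang : Set → Set₁
Lang A = List A → Set

data ⟦_⟧ {A : Set} : RegExp A → Lang A where
  ⟦𝟙⟧   : ⟦ 𝟙 ⟧ []
  ⟦lit⟧ : ∀ a → ⟦ lit a ⟧ (a ∷ [])
  ⟦⊕ˡ⟧  : ∀ {e f w} → ⟦ e ⟧ w → ⟦ e ⊕ f ⟧ w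
  ⟦⊕ʳ⟧  : ∀ {e f w} → ⟦ f ⟧ w → ⟦ e ⊕ f ⟧ w
  ⟦⊙⟧   : ∀ {e f u v} → ⟦ e ⟧ u → ⟦ f ⟧ v → ⟦ e ⊙ f ⟧ (u ++ v)
  ⟦⋆0⟧  : ∀ {e} → ⟦ e ⋆ ⟧ []
  ⟦⋆s⟧  : ∀ {e u v} → ⟦ e ⟧ u → ⟦ e ⋆ ⟧ v → ⟦ e ⋆ ⟧ (u ++ v)

_⊆_ : {A : Set} → Lang A → Lang A → Set
K ⊆ L = ∀ w → K w → L w

word : {A : Set} → List A → RegExp A
word = foldr (λ a e → lit a ⊙ e) 𝟙

Monotone : {A : Set} → (RegExp A → RegExp A) → Set
Monotone h = ∀ e f → ⟦ e ⟧ ⊆ ⟦ f ⟧ → ⟦ h e ⟧ ⊆ ⟦ h f ⟧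

Linear : {A : Set} → (RegExp A → RegExp A) → Set
Linear h = ∀ e → (∀ x → ⟦ h e ⟧ x → ∃[ w ] (⟦ e ⟧ w × ⟦ h (word w) ⟧ x))
               × (∀ x → (∃[ w ] (⟦ e ⟧ w × ⟦ h (word w) ⟧ x)) → ⟦ h e ⟧ x)

-- A set of hypotheses e ≤ f, given as a predicate on pairs (e , f)
Hyps : Set → Set₁
Hyps A = RegExp A → RegExp A → Set

_·⟦_⟧·_ : {A : Set} → List A → RegExp A → List A → Lang A
(u ·⟦ e ⟧· v) x = ∃[ y ] (⟦ e ⟧ y × x ≡ u ++ y ++ v)

oneStep : {A : Set} → Hyps A → Lang A → Lang A
oneStep G L x = ∃[ e ] ∃[ f ] ∃[ u ] ∃[ v ]
  (G e f × (u ·⟦ f ⟧· v) ⊆ L × (u ·⟦ e ⟧· v) x)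

HypAll : {A : Set} → (RegExp A → RegExp A) → (RegExp A → RegExp A) → Hyps A
HypAll l r e f = ∃[ g ] (e ≡ l g × f ≡ r g)

HypWords : {A : Set} → (RegExp A → RegExp A) → (RegExp A → RegExp A) → Hyps A
HypWords l r e f = ∃[ w ] (e ≡ l (word w) × f ≡ r (word w))

{-# OPTIONS --safe #-}
module Submission where

-- Every hypothesis l(w) ≤ r(w) of H' is an instance of H, so H' generates no more than H.
-- Conversely, if u⟦r(e)⟧v ⊆ L and x ∈ u⟦l(e)⟧v, then by linearity of l the middle part of x
-- lies in ⟦l(w)⟧ for some w ∈ ⟦e⟧; since ⟦w⟧ = {w} ⊆ ⟦e⟧, monotonicity of r gives
-- u⟦r(w)⟧v ⊆ u⟦r(e)⟧v ⊆ L, so x is produced by the hypothesis l(w) ≤ r(w) of H'.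

open import Defs
open import Data.List using (List; []; _∷_)
open import Data.Product using (_×_; _,_; proj₁)
open import Relation.Binary.PropositionalEquality using (_≡_; refl; sym; subst)

⟦word⟧⇒≡ : {A : Set} (w : List A) {z : List A} → ⟦ word w ⟧ z → z ≡ w
⟦word⟧⇒≡ []      ⟦𝟙⟧ = refl
⟦word⟧⇒≡ (a ∷ w) (⟦⊙⟧ (⟦lit⟧ .a) z∈w) with ⟦word⟧⇒≡ w z∈w
... | refl = refl

word-⊆ : {A : Set} {e : RegExp A} {w : List A} → ⟦ e ⟧ w → ⟦ word w ⟧ ⊆ ⟦ e ⟧
word-⊆ {e = e} w∈e z z∈w = subst ⟦ e ⟧ (sym (⟦word⟧⇒≡ _ z∈w)) w∈e

·⟦⟧·-mono : {A : Set} (u v : List A) {e f : RegExp A} →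
            ⟦ e ⟧ ⊆ ⟦ f ⟧ → (u ·⟦ e ⟧· v) ⊆ (u ·⟦ f ⟧· v)
·⟦⟧·-mono u v e⊆f x (y , y∈e , x≡uyv) = y , e⊆f y y∈e , x≡uyv

oneStep-monoʰ : {A : Set} {G G′ : Hyps A} → (∀ {e f} → G e f → G′ e f) →
                (L : Lang A) → oneStep G L ⊆ oneStep G′ L
oneStep-monoʰ G⇒G′ L x (e , f , u , v , e≤f , uf⊆L , x∈ue) =
  e , f , u , v , G⇒G′ e≤f , uf⊆L , x∈ue

HypWords⇒HypAll : {A : Set} (l r : RegExp A → RegExp A) {e f : RegExp A} →
                  HypWords l r e f → HypAll l r e f
HypWords⇒HypAll l r (w , e≡lw , f≡rw) = word w , e≡lw , f≡rw

oneStep-HypAll⊆HypWords : {A : Set} (l r : RegExp A → RegExp A) → Linear l → Monotone r →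
                          (L : Lang A) → oneStep (HypAll l r) L ⊆ oneStep (HypWords l r) L
oneStep-HypAll⊆HypWords l r lin mon L x
  (.(l g) , .(r g) , u , v , (g , refl , refl) , urgv⊆L , (y , y∈lg , x≡uyv))
  with proj₁ (lin g) y y∈lg
... | w , w∈g , y∈lw =
  l (word w) , r (word w) , u , v , (w , refl , refl) ,
  (λ z z∈urwv → urgv⊆L z (·⟦⟧·-mono u v (mon (word w) g (word-⊆ w∈g)) z z∈urwv)) ,
  (y , y∈lw , x≡uyv)

proposition5p13 : {A : Set} (l r : RegExp A → RegExp A) → Linear l → Monotone r →
    (L : Lang A) → (oneStep (HypAll l r) L ⊆ oneStep (HypWords l r) L)
      × (oneStep (HypWords l r) L ⊆ oneStep (HypAll l r) L)
proposition5p13 l r lin mon L =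
  oneStep-HypAll⊆HypWords l r lin mon L , oneStep-monoʰ (HypWords⇒HypAll l r) L
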